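{- Let $G$ be a split graph with clusters $C_0, \dots, C_{m-1}$, $C_i = (U_i, V_i, E_i)$, as in the context. If $I$ and $I'$ are typical independent sets of $G$ with $|I \cap U_i| = |I' \cap U_i|$ for every $i \in \{0, \dots, m-1\}$ (i.e., with the same distribution), then $I \rightsquigarrow_2 I'$.
   Context: For independent sets $I, J$ of a graph $G$, write $I \leftrightarrow_2 J$ if $|I \setminus J| = |J \setminus I| = 1$ and $\mathrm{dist}_G(u,v) \le 2$ where $I \setminus J = \{u\}$, $J \setminus I = \{v\}$; write $I \rightsquigarrow_2 J$ if there is a finite sequence $I = I_0, \dots, I_\ell = J$ ($\ell \ge 0$) of independent sets with $I_j \leftrightarrow_2 I_{j+1}$ for all $j$. Setting: $G$ is a split graph with vertex set partitioned as $V^A \cup U^B$, where $V^A$ is a clique and $U^B$ is an independent set, and every vertex of $U^B$ has a neighbor in $V^A$. Let $V^B \subseteq V^A$ be the set of vertices of $V^A$ having a neighbor in $U^B$, and let $G^B$ be the bipartite graph with parts $V^B$ and $U^B$ whose edges are the edges of $G$ between $V^A$ and $U^B$. A cluster is a connected component of $G^B$, written $(U_C, V_C, E_C)$ with $U_C \subseteq U^B$, $V_C \subseteq V^B$; in addition, if $V' = V^A \setminus V^B \neq \emptyset$, then $(\emptyset, V', \emptyset)$ is also a cluster. The clusters are $C_0, \dots, C_{m-1}$. A typical independent set is an independent set $I$ with $I \cap V^A = \emptyset$; its distribution is the vector $(|I \cap U_i|)_{0 \le i \le m-1}$. -}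

module Defs where

open import Data.Nat using (ℕ)
open import Data.Bool using (Bool; true; false; not; _∧_; _xor_)
open import Data.Fin using (Fin; _≟_)
open import Data.Fin.Subset using (Subset; _∈_; _∉_; ∣_∣; _∩_)
open import Data.Vec using (tabulate)
open import Data.Product using (Σ; _×_; ∃; ∃-syntax)
open import Data.Sum using (_⊎_)
open import Relation.Nullary using (¬_)
open import Relation.Nullary.Decidable using (⌊_⌋)
open import Relation.Binary.PropositionalEquality using (_≡_)
open import Relation.Binary.Construct.Closure.ReflexiveTransitive using (Star)
open import Function.Bundles using (_⇔_)

record Graph (n : ℕ) : Set where
  field
    adj   : Fin n → Fin n → Bool
    sym   : ∀ x y → adj x y ≡ adj y x
    irrefl : ∀ x → adj x x ≡ false
open Graph public

module _ {n : ℕ} (G : Graph n) where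

  Adj : Fin n → Fin n → Set
  Adj x y = adj G x y ≡ true

  Independent : Subset n → Set
  Independent I = ∀ x y → x ∈ I → y ∈ I → adj G x y ≡ false

  Dist≤2 : Fin n → Fin n → Set
  Dist≤2 u v = u ≡ v ⊎ (Adj u v ⊎ ∃[ w ] (Adj u w × Adj w v))

  Swap₂ : Subset n → Subset n → Set
  Swap₂ I J = ∃[ u ] ∃[ v ]
      ((∀ w → (w ∈ I × w ∉ J) ⇔ (w ≡ u))
    × (∀ w → (w ∈ J × w ∉ I) ⇔ (w ≡ v))
    × Dist≤2 u v)

  Step₂ : Subset n → Subset n → Set
  Step₂ I J = Independent I × Independent J × Swap₂ I J

  Reconf₂ : Subset n → Subset n → Set
  Reconf₂ = Star Step₂

  -- Split graph with partition V^A (inA x ≡ true, a clique) and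
  -- U^B (inA x ≡ false, an independent set); every vertex of U^B
  -- has a neighbour in V^A.
  record IsSplit (inA : Fin n → Bool) : Set where
    field
      clique  : ∀ x y → inA x ≡ true → inA y ≡ true → ¬ x ≡ y → Adj x y
      indep   : ∀ x y → inA x ≡ false → inA y ≡ false → adj G x y ≡ false
      covered : ∀ u → inA u ≡ false → ∃[ v ] (inA v ≡ true × Adj u v)

  module _ (inA : Fin n → Bool) where

    InVB : Fin n → Set
    InVB v = inA v ≡ true × ∃[ u ] (inA u ≡ false × Adj v u)

    InGB : Fin n → Set
    InGB x = InVB x ⊎ inA x ≡ false

    InV' : Fin n → Set
    InV' x = inA x ≡ true × ¬ InVB x

    EdgeB : Fin n → Fin n → Set
    EdgeB x y = Adj x y × (inA x xor inA y) ≡ true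

    ConnB : Fin n → Fin n → Set
    ConnB = Star EdgeB

    -- A labelling c : Fin n → Fin m of the vertices by clusters C_0..C_{m-1}:
    -- the connected components of G^B, plus (∅, V', ∅) if V' ≠ ∅.
    -- Every label is used, so there are exactly m clusters.
    record IsClustering (m : ℕ) (c : Fin n → Fin m) : Set where
      field
        comp     : ∀ x y → InGB x → InGB y → (c x ≡ c y) ⇔ ConnB x y
        v'-same  : ∀ x y → InV' x → InV' y → c x ≡ c y
        v'-apart : ∀ x y → InV' x → InGB y → ¬ c x ≡ c y
        onto     : ∀ (i : Fin m) → ∃[ x ] (c x ≡ i)

    Ucl : {m : ℕ} → (Fin n → Fin m) → Fin m → Subset n
    Ucl c i = tabulate (λ x → not (inA x) ∧ ⌊ c x ≟ i ⌋)

    Typical : Subset n → Set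
    Typical I = Independent I × (∀ x → x ∈ I → inA x ≡ false)

    SameDistribution : {m : ℕ} → (Fin n → Fin m) → Subset n → Subset n → Set
    SameDistribution c I J = ∀ i → ∣ I ∩ Ucl c i ∣ ≡ ∣ J ∩ Ucl c i ∣

{-# OPTIONS --safe #-}

-- Every vertex set inside Uᴮ is independent, so a typical set may move a token
-- from u to any vacant w ∈ Uᴮ at distance at most 2.  A path of Gᴮ alternates
-- between Vᴮ and Uᴮ, so two vertices of Uᴮ in one cluster are joined by a chain
-- of Uᴮ-vertices each at distance 2 from the next, and a token can be carried
-- along such a chain to a vacant endpoint.  If I ≠ I', equal counts in every
-- cluster give u ∈ I ∖ I' and w ∈ I' ∖ I in a common cluster; carrying u to w
-- keeps the distribution and shrinks I ∖ I', so induction on |I ∖ I'| ends at I'.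

module Submission where

open import Defs hiding (sym)
open import Data.Bool using (Bool; true; false; not; _∧_; _xor_)
open import Data.Bool.Properties using (not-injective)
open import Data.Fin using (Fin; zero; suc; _≟_)
open import Data.Fin.Subset
open import Data.Fin.Subset.Properties
open import Data.Nat using (ℕ; suc; _<_)
open import Data.Nat.Induction using (<-wellFounded)
open import Data.Nat.Properties using (<⇒≢)
open import Data.Product using (_×_; _,_; proj₁; ∃-syntax)
open import Data.Sum using (_⊎_; inj₁; inj₂)
open import Data.Vec using (_∷_; here; there)
open import Data.Vec.Properties using (lookup∘tabulate; lookup⇒[]=; []=⇒lookup)
open import Function using (_∘_)
open import Function.Bundles using (_⇔_; mk⇔; Equivalence)
open import Induction.WellFounded using (Acc; acc)
open import Level using (0ℓ)
open import Relation.Binary using (Rel)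
open import Relation.Binary.Construct.Closure.ReflexiveTransitive using (Star; ε; _◅_; _◅◅_)
open import Relation.Binary.PropositionalEquality
  using (_≡_; _≢_; refl; cong; cong₂; sym; trans; subst; module ≡-Reasoning)
open import Relation.Nullary using (yes; no; contradiction)
open import Relation.Nullary.Decidable using (⌊_⌋; dec-true; isYes≗does)

private variable
  n : ℕ
  p q : Subset n
  u v w x : Fin n

x∈p─q⇒x∉q : ∀ (p q : Subset n) → x ∈ p ─ q → x ∉ q
x∈p─q⇒x∉q (_ ∷ p) (inside  ∷ q) (there x∈p─q) (there x∈q) = x∈p─q⇒x∉q p q x∈p─q x∈q
x∈p─q⇒x∉q (_ ∷ p) (outside ∷ q) (there x∈p─q) (there x∈q) = x∈p─q⇒x∉q p q x∈p─q x∈q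

x∈p⇒suc∣p-x∣≡∣p∣ : ∀ (p : Subset n) → x ∈ p → suc ∣ p - x ∣ ≡ ∣ p ∣
x∈p⇒suc∣p-x∣≡∣p∣ (inside  ∷ p) here        = cong (suc ∘ ∣_∣) (p─⊥≡p p)
x∈p⇒suc∣p-x∣≡∣p∣ (inside  ∷ p) (there x∈p) = cong suc (x∈p⇒suc∣p-x∣≡∣p∣ p x∈p)
x∈p⇒suc∣p-x∣≡∣p∣ (outside ∷ p) (there x∈p) = x∈p⇒suc∣p-x∣≡∣p∣ p x∈p

x∉p⇒∣p∪⁅x⁆∣≡suc∣p∣ : ∀ (p : Subset n) x → x ∉ p → ∣ p ∪ ⁅ x ⁆ ∣ ≡ suc ∣ p ∣
x∉p⇒∣p∪⁅x⁆∣≡suc∣p∣ (inside  ∷ p) zero    x∉p = contradiction here x∉p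
x∉p⇒∣p∪⁅x⁆∣≡suc∣p∣ (outside ∷ p) zero    x∉p = cong (suc ∘ ∣_∣) (∪-identityʳ p)
x∉p⇒∣p∪⁅x⁆∣≡suc∣p∣ (inside  ∷ p) (suc x) x∉p = cong suc (x∉p⇒∣p∪⁅x⁆∣≡suc∣p∣ p x (x∉p ∘ there))
x∉p⇒∣p∪⁅x⁆∣≡suc∣p∣ (outside ∷ p) (suc x) x∉p = x∉p⇒∣p∪⁅x⁆∣≡suc∣p∣ p x (x∉p ∘ there)

slide : Subset n → Fin n → Fin n → Subset n
slide p u w = (p - u) ∪ ⁅ w ⁆

w∈slide : ∀ (p : Subset n) u w → w ∈ slide p u w
w∈slide p u w = x∈p∪q⁺ (inj₂ (x∈⁅x⁆ w))

∈slide⁺ : x ≢ u → x ∈ p → x ∈ slide p u w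
∈slide⁺ x≢u x∈p = x∈p∪q⁺ (inj₁ (x∈p∧x≢y⇒x∈p-y x∈p x≢u))

∈slide⁻ : ∀ (p : Subset n) u w → x ∈ slide p u w → x ≡ w ⊎ (x ≢ u × x ∈ p)
∈slide⁻ p u w x∈ with x∈p∪q⁻ (p - u) ⁅ w ⁆ x∈
... | inj₁ x∈p-u = inj₂ (x∉⁅y⁆⇒x≢y (x∈p─q⇒x∉q p ⁅ u ⁆ x∈p-u) , p─q⊆p p ⁅ u ⁆ x∈p-u)
... | inj₂ x∈⁅w⁆ = inj₁ (x∈⁅y⁆⇒x≡y w x∈⁅w⁆)

∉slide : ∀ (p : Subset n) u {w} → x ≢ w → x ∉ p → x ∉ slide p u w
∉slide p u x≢w x∉p x∈ with ∈slide⁻ p u _ x∈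
... | inj₁ x≡w       = x≢w x≡w
... | inj₂ (_ , x∈p) = x∉p x∈p

u∉slide : ∀ (p : Subset n) {u w} → u ≢ w → u ∉ slide p u w
u∉slide p u≢w u∈ with ∈slide⁻ p _ _ u∈
... | inj₁ u≡w       = u≢w u≡w
... | inj₂ (u≢u , _) = u≢u refl

∣slide∣ : ∀ (p : Subset n) → u ∈ p → w ∉ p → ∣ slide p u w ∣ ≡ ∣ p ∣
∣slide∣ {u = u} {w} p u∈p w∉p = begin
  ∣ (p - u) ∪ ⁅ w ⁆ ∣  ≡⟨ x∉p⇒∣p∪⁅x⁆∣≡suc∣p∣ (p - u) w (w∉p ∘ p─q⊆p p ⁅ u ⁆) ⟩
  suc ∣ p - u ∣        ≡⟨ x∈p⇒suc∣p-x∣≡∣p∣ p u∈p ⟩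
  ∣ p ∣                ∎
  where open ≡-Reasoning

slide-∩-inside : ∀ (p : Subset n) → u ∈ q → w ∈ q → slide p u w ∩ q ≡ slide (p ∩ q) u w
slide-∩-inside {u = u} {q = q} {w = w} p u∈q w∈q = ⊆-antisym l⊆r r⊆l
  where
  l⊆r : slide p u w ∩ q ⊆ slide (p ∩ q) u w
  l⊆r x∈ with x∈p∩q⁻ _ q x∈
  ... | x∈s , x∈q with ∈slide⁻ p u w x∈s
  ...   | inj₁ refl        = w∈slide (p ∩ q) u w
  ...   | inj₂ (x≢u , x∈p) = ∈slide⁺ x≢u (x∈p∩q⁺ (x∈p , x∈q))
  r⊆l : slide (p ∩ q) u w ⊆ slide p u w ∩ q
  r⊆l x∈ with ∈slide⁻ (p ∩ q) u w x∈
  ... | inj₁ refl          = x∈p∩q⁺ (w∈slide p u w , w∈q)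
  ... | inj₂ (x≢u , x∈p∩q) with x∈p∩q⁻ p q x∈p∩q
  ...   | x∈p , x∈q = x∈p∩q⁺ (∈slide⁺ x≢u x∈p , x∈q)

slide-∩-outside : ∀ (p : Subset n) → u ∉ q → w ∉ q → slide p u w ∩ q ≡ p ∩ q
slide-∩-outside {u = u} {q = q} {w = w} p u∉q w∉q = ⊆-antisym l⊆r r⊆l
  where
  l⊆r : slide p u w ∩ q ⊆ p ∩ q
  l⊆r x∈ with x∈p∩q⁻ _ q x∈
  ... | x∈s , x∈q with ∈slide⁻ p u w x∈s
  ...   | inj₁ refl      = contradiction x∈q w∉q
  ...   | inj₂ (_ , x∈p) = x∈p∩q⁺ (x∈p , x∈q)
  r⊆l : p ∩ q ⊆ slide p u w ∩ q
  r⊆l x∈ with x∈p∩q⁻ p q x∈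
  ... | x∈p , x∈q = x∈p∩q⁺ (∈slide⁺ (λ { refl → u∉q x∈q }) x∈p , x∈q)

∣slide∩∣ : ∀ (p q : Subset n) → u ∈ p → w ∉ p → (u ∈ q ⇔ w ∈ q) →
  ∣ slide p u w ∩ q ∣ ≡ ∣ p ∩ q ∣
∣slide∩∣ {u = u} {w = w} p q u∈p w∉p u∈q⇔w∈q with u ∈? q
... | yes u∈q = trans (cong ∣_∣ (slide-∩-inside p u∈q w∈q))
                      (∣slide∣ (p ∩ q) (x∈p∩q⁺ (u∈p , u∈q)) (w∉p ∘ proj₁ ∘ x∈p∩q⁻ p q))
  where
  w∈q : w ∈ q
  w∈q = Equivalence.to u∈q⇔w∈q u∈q
... | no u∉q  = cong ∣_∣ (slide-∩-outside p u∉q (u∉q ∘ Equivalence.from u∈q⇔w∈q))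

Empty[p─q]⇒p⊆q : ∀ (p q : Subset n) → Empty (p ─ q) → p ⊆ q
Empty[p─q]⇒p⊆q p q empty {x} x∈p with x ∈? q
... | yes x∈q = x∈q
... | no x∉q  = contradiction (x , x∈p∧x∉q⇒x∈p─q x∈p x∉q) empty

∣p∣≡∣q∣∧p─q≢∅⇒q─p≢∅ : ∀ (p q : Subset n) → ∣ p ∣ ≡ ∣ q ∣ →
  Nonempty (p ─ q) → Nonempty (q ─ p)
∣p∣≡∣q∣∧p─q≢∅⇒q─p≢∅ p q ∣p∣≡∣q∣ (x , x∈p─q) with nonempty? (q ─ p)
... | yes q─p≢∅ = q─p≢∅
... | no  q─p≡∅ = contradiction (sym ∣p∣≡∣q∣) (<⇒≢ (p⊂q⇒∣p∣<∣q∣ q⊂p))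
  where
  q⊂p : q ⊂ p
  q⊂p = Empty[p─q]⇒p⊆q q p q─p≡∅ , x , p─q⊆p p q x∈p─q , x∈p─q⇒x∉q p q x∈p─q

slide-via-vacant : ∀ (p : Subset n) → v ∉ p → slide (slide p u v) v w ≡ slide p u w
slide-via-vacant {v = v} {u} {w} p v∉p = ⊆-antisym l⊆r r⊆l
  where
  l⊆r : slide (slide p u v) v w ⊆ slide p u w
  l⊆r x∈ with ∈slide⁻ _ v w x∈
  ... | inj₁ refl       = w∈slide p u w
  ... | inj₂ (x≢v , x∈s) with ∈slide⁻ p u v x∈s
  ...   | inj₁ x≡v         = contradiction x≡v x≢v
  ...   | inj₂ (x≢u , x∈p) = ∈slide⁺ x≢u x∈p
  r⊆l : slide p u w ⊆ slide (slide p u v) v w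
  r⊆l x∈ with ∈slide⁻ p u w x∈
  ... | inj₁ refl        = w∈slide _ v w
  ... | inj₂ (x≢u , x∈p) = ∈slide⁺ (λ { refl → v∉p x∈p }) (∈slide⁺ x≢u x∈p)

slide-via-occupied : ∀ (p : Subset n) → v ∈ p → v ≢ u → u ≢ w → slide (slide p v w) u v ≡ slide p u w
slide-via-occupied {v = v} {u} {w} p v∈p v≢u u≢w = ⊆-antisym l⊆r r⊆l
  where
  l⊆r : slide (slide p v w) u v ⊆ slide p u w
  l⊆r x∈ with ∈slide⁻ _ u v x∈
  ... | inj₁ refl        = ∈slide⁺ v≢u v∈p
  ... | inj₂ (x≢u , x∈s) with ∈slide⁻ p v w x∈s
  ...   | inj₁ refl      = w∈slide p u w
  ...   | inj₂ (_ , x∈p) = ∈slide⁺ x≢u x∈p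
  r⊆l : slide p u w ⊆ slide (slide p v w) u v
  r⊆l {x} x∈ with ∈slide⁻ p u w x∈ | x ≟ v
  ... | inj₁ refl        | _        = ∈slide⁺ (u≢w ∘ sym) (w∈slide p v w)
  ... | inj₂ _           | yes refl = w∈slide _ u v
  ... | inj₂ (x≢u , x∈p) | no x≢v   = ∈slide⁺ x≢u (∈slide⁺ x≢v x∈p)

slide-─-⊂ : ∀ (p q : Subset n) → w ∈ q → u ∈ p ─ q → slide p u w ─ q ⊂ p ─ q
slide-─-⊂ {w = w} {u} p q w∈q u∈p─q = l⊆r , u , u∈p─q , u∉l
  where
  l⊆r : slide p u w ─ q ⊆ p ─ q
  l⊆r x∈ with ∈slide⁻ p u w (p─q⊆p _ q x∈)
  ... | inj₁ refl      = contradiction w∈q (x∈p─q⇒x∉q _ q x∈)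
  ... | inj₂ (_ , x∈p) = x∈p∧x∉q⇒x∈p─q x∈p (x∈p─q⇒x∉q _ q x∈)
  u∉l : u ∉ slide p u w ─ q
  u∉l = u∉slide p (λ { refl → x∈p─q⇒x∉q p q u∈p─q w∈q }) ∘ p─q⊆p _ q

module _ {n ℓ} (R : Rel (Fin n) ℓ) where

  data Slide : Rel (Subset n) ℓ where
    slide-step : ∀ {p u w} → R u w → u ∈ p → w ∉ p → Slide p (slide p u w)

  slide-along : ∀ {p u w} → Star R u w → u ∈ p → w ∉ p → Star Slide p (slide p u w)
  slide-along ε u∈p u∉p = contradiction u∈p u∉p
  slide-along {p} {u} {w} (_◅_ {j = v} Ruv v⇝w) u∈p w∉p with v ≟ w | v ≟ u | v ∈? p
  ... | yes refl | _        | _       = slide-step Ruv u∈p w∉p ◅ ε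
  ... | no _     | yes refl | _       = slide-along v⇝w u∈p w∉p
  ... | no v≢w   | no v≢u   | no v∉p  =
    slide-step Ruv u∈p v∉p
      ◅ subst (Star Slide _) (slide-via-vacant p v∉p)
              (slide-along v⇝w (w∈slide p u v) (∉slide p u (v≢w ∘ sym) w∉p))
  ... | no v≢w   | no v≢u   | yes v∈p =
    -- v is occupied: its own token goes on to w first, then u moves into v.
    subst (Star Slide p) (slide-via-occupied p v∈p v≢u u≢w)
          (slide-along v⇝w v∈p w∉p
            ◅◅ slide-step Ruv (∈slide⁺ (v≢u ∘ sym) u∈p) (u∉slide p v≢w) ◅ ε)
    where
    u≢w : u ≢ w
    u≢w refl = w∉p u∈p

slide-swap₂ : ∀ {n} (G : Graph n) {I u w} → u ∈ I → w ∉ I → Dist≤2 G u w → Swap₂ G I (slide I u w)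
slide-swap₂ G {I} {u} {w} u∈I w∉I u~w =
  u , w , (λ x → mk⇔ (left x) λ { refl → u∈I , u∉slide I u≢w })
        , (λ x → mk⇔ (right x) λ { refl → w∈slide I u w , w∉I })
        , u~w
  where
  u≢w : u ≢ w
  u≢w refl = w∉I u∈I
  left : ∀ x → x ∈ I × x ∉ slide I u w → x ≡ u
  left x (x∈I , x∉J) with x ≟ u
  ... | yes x≡u = x≡u
  ... | no x≢u  = contradiction (∈slide⁺ x≢u x∈I) x∉J
  right : ∀ x → x ∈ slide I u w × x ∉ I → x ≡ w
  right x (x∈J , x∉I) with ∈slide⁻ I u w x∈J
  ... | inj₁ x≡w       = x≡w
  ... | inj₂ (_ , x∈I) = contradiction x∈I x∉I

module _ {n} (G : Graph n) (inA : Fin n → Bool) where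

  InUᴮ : Subset n → Set
  InUᴮ I = ∀ x → x ∈ I → inA x ≡ false

  slide-InUᴮ : ∀ {I u w} → InUᴮ I → inA w ≡ false → InUᴮ (slide I u w)
  slide-InUᴮ {I} {u} {w} I⊆U w∉A x x∈ with ∈slide⁻ I u w x∈
  ... | inj₁ refl      = w∉A
  ... | inj₂ (_ , x∈I) = I⊆U x x∈I

  Hop : Rel (Fin n) 0ℓ
  Hop u w = inA w ≡ false × ∃[ v ] (Adj G u v × Adj G v w)

  connB⇒hops : ∀ {u w} → inA u ≡ false → inA w ≡ false → ConnB G inA u w → Star Hop u w
  connB⇒hops u∉A w∉A ε = ε
  connB⇒hops u∉A w∉A ((_ , u-w) ◅ ε) rewrite u∉A | w∉A = contradiction u-w λ ()
  connB⇒hops u∉A w∉A (_◅_ {j = v} (uv , u-v) (_◅_ {j = x} (vx , v-x) x⇝w)) =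
    (x∉A , v , uv , vx) ◅ connB⇒hops x∉A w∉A x⇝w
    where
    v∈A : inA v ≡ true
    v∈A = subst (λ b → (b xor inA v) ≡ true) u∉A u-v
    x∉A : inA x ≡ false
    x∉A = not-injective (subst (λ b → (b xor inA x) ≡ true) v∈A v-x)

  IndependentUᴮ : Set
  IndependentUᴮ = ∀ x y → inA x ≡ false → inA y ≡ false → adj G x y ≡ false

  module _ (Uᴮ-independent : IndependentUᴮ) where

    InUᴮ⇒independent : ∀ {I} → InUᴮ I → Independent G I
    InUᴮ⇒independent I⊆U x y x∈I y∈I = Uᴮ-independent x y (I⊆U x x∈I) (I⊆U y y∈I)

    slides⇒reconf₂ : ∀ {I J} → InUᴮ I → Star (Slide Hop) I J → Reconf₂ G I J
    slides⇒reconf₂ I⊆U ε = ε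
    slides⇒reconf₂ {I} I⊆U (slide-step {u = u} {w = w} (w∉A , u~w) u∈I w∉I ◅ rest) =
      (InUᴮ⇒independent I⊆U , InUᴮ⇒independent J⊆U , slide-swap₂ G u∈I w∉I (inj₂ (inj₂ u~w)))
        ◅ slides⇒reconf₂ J⊆U rest
      where
      J⊆U : InUᴮ (slide I u w)
      J⊆U = slide-InUᴮ I⊆U w∉A

  module _ {m} {c : Fin n → Fin m} where

    ∈Ucl⁺ : ∀ {x} → inA x ≡ false → x ∈ Ucl G inA c (c x)
    ∈Ucl⁺ {x} x∉A = lookup⇒[]= x _ (trans (lookup∘tabulate _ x) (cong₂ _∧_ (cong not x∉A) cx≟cx))
      where
      cx≟cx : ⌊ c x ≟ c x ⌋ ≡ true
      cx≟cx = trans (isYes≗does (c x ≟ c x)) (dec-true (c x ≟ c x) refl)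

    ∈Ucl⁻ : ∀ {x i} → x ∈ Ucl G inA c i → inA x ≡ false × c x ≡ i
    ∈Ucl⁻ {x} {i} x∈U with inA x | c x ≟ i | trans (sym (lookup∘tabulate _ x)) ([]=⇒lookup x∈U)
    ... | false | yes cx≡i | _ = refl , cx≡i
    ... | false | no _     | ()
    ... | true  | _        | ()

    Ucl-same-cluster : ∀ {u w i} → inA w ≡ false → c u ≡ c w → u ∈ Ucl G inA c i → w ∈ Ucl G inA c i
    Ucl-same-cluster {w = w} w∉A cu≡cw u∈U with ∈Ucl⁻ u∈U
    ... | _ , refl = subst (λ j → w ∈ Ucl G inA c j) (sym cu≡cw) (∈Ucl⁺ w∉A)

    partner : ∀ {I J u} → SameDistribution G inA c I J → u ∈ I → u ∉ J → inA u ≡ false →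
      ∃[ w ] (w ∈ J × w ∉ I × inA w ≡ false × c u ≡ c w)
    partner {I} {J} {u} same u∈I u∉J u∉A
      with ∣p∣≡∣q∣∧p─q≢∅⇒q─p≢∅ (I ∩ U) (J ∩ U) (same (c u))
             (u , x∈p∧x∉q⇒x∈p─q (x∈p∩q⁺ (u∈I , ∈Ucl⁺ u∉A)) (u∉J ∘ proj₁ ∘ x∈p∩q⁻ J U))
      where
      U : Subset n
      U = Ucl G inA c (c u)
    ... | w , w∈J∩U─I∩U with x∈p∩q⁻ J _ (p─q⊆p _ _ w∈J∩U─I∩U)
    ...   | w∈J , w∈U with ∈Ucl⁻ w∈U
    ...     | w∉A , cw≡cu =
      w , w∈J , (λ w∈I → x∈p─q⇒x∉q _ _ w∈J∩U─I∩U (x∈p∩q⁺ (w∈I , w∈U))) , w∉A , sym cw≡cu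

    SameDistribution∧Empty⇒≡ : ∀ {I I'} → InUᴮ I' → SameDistribution G inA c I I' →
      Empty (I ─ I') → I ≡ I'
    SameDistribution∧Empty⇒≡ {I} {I'} I'⊆U same I─I'≡∅ =
      ⊆-antisym (Empty[p─q]⇒p⊆q I I' I─I'≡∅) (Empty[p─q]⇒p⊆q I' I I'─I≡∅)
      where
      I'─I≡∅ : Empty (I' ─ I)
      I'─I≡∅ (x , x∈I'─I) with partner (sym ∘ same) x∈I' (x∈p─q⇒x∉q I' I x∈I'─I) (I'⊆U x x∈I')
        where
        x∈I' : x ∈ I'
        x∈I' = p─q⊆p I' I x∈I'─I
      ... | w , w∈I , w∉I' , _ = I─I'≡∅ (w , x∈p∧x∉q⇒x∈p─q w∈I w∉I')

    module _ (Uᴮ-independent : IndependentUᴮ) (C : IsClustering G inA m c) where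
      open IsClustering C using (comp)

      slide-toward : ∀ {I I' u} → InUᴮ I → SameDistribution G inA c I I' → u ∈ I → u ∉ I' →
        ∃[ J ] (Reconf₂ G I J × InUᴮ J × SameDistribution G inA c J I' × J ─ I' ⊂ I ─ I')
      slide-toward {I} {I'} {u} I⊆U same u∈I u∉I' with partner same u∈I u∉I' (I⊆U u u∈I)
      ... | w , w∈I' , w∉I , w∉A , cu≡cw =
        slide I u w , slides⇒reconf₂ Uᴮ-independent I⊆U (slide-along Hop hops u∈I w∉I) ,
        slide-InUᴮ I⊆U w∉A , same′ , slide-─-⊂ I I' w∈I' (x∈p∧x∉q⇒x∈p─q u∈I u∉I')
        where
        u∉A : inA u ≡ false
        u∉A = I⊆U u u∈I
        hops : Star Hop u w
        hops = connB⇒hops u∉A w∉A (Equivalence.to (comp u w (inj₂ u∉A) (inj₂ w∉A)) cu≡cw)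
        same′ : SameDistribution G inA c (slide I u w) I'
        same′ i = trans (∣slide∩∣ I (Ucl G inA c i) u∈I w∉I
                          (mk⇔ (Ucl-same-cluster w∉A cu≡cw) (Ucl-same-cluster u∉A (sym cu≡cw))))
                        (same i)

      reconf-typical : ∀ {I I'} → Acc _<_ ∣ I ─ I' ∣ → InUᴮ I → InUᴮ I' →
        SameDistribution G inA c I I' → Reconf₂ G I I'
      reconf-typical {I} {I'} (acc smaller) I⊆U I'⊆U same with nonempty? (I ─ I')
      ... | no I─I'≡∅ = subst (Reconf₂ G I) (SameDistribution∧Empty⇒≡ I'⊆U same I─I'≡∅) ε
      ... | yes (u , u∈I─I')
        with slide-toward I⊆U same (p─q⊆p I I' u∈I─I') (x∈p─q⇒x∉q I I' u∈I─I')
      ...   | J , I⇝J , J⊆U , same′ , J─I'⊂I─I' =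
        I⇝J ◅◅ reconf-typical (smaller (p⊂q⇒∣p∣<∣q∣ J─I'⊂I─I')) J⊆U I'⊆U same′

corollary1 : ∀ {n : ℕ} (G : Graph n) (inA : Fin n → Bool) → IsSplit G inA →
    ∀ (m : ℕ) (c : Fin n → Fin m) → IsClustering G inA m c →
    ∀ (I I' : Subset n) → Typical G inA I → Typical G inA I' →
    SameDistribution G inA c I I' → Reconf₂ G I I'
corollary1 G inA S m c C I I' (_ , I⊆Uᴮ) (_ , I'⊆Uᴮ) same =
  reconf-typical G inA (IsSplit.indep S) C (<-wellFounded _) I⊆Uᴮ I'⊆Uᴮ same
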